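{- Let $\mathbf P=(P,\le)$ be a poset. Then the following holds: (i) $(\mathrm{Conv}\,\mathbf P,\sqsubseteq)$ is a poset, (ii) if $\mathbf P$ has a smallest element $0$ and a greatest element $1$ then $(\mathrm{Conv}^*\mathbf P,\sqsubseteq,\{0\},\{1\})$ is a bounded poset.
   Context: For a poset $(P,\le)$ and $A,B\subseteq P$: $A\le_1B$ means that for every $x\in A$ there exists some $y\in B$ with $x\le y$; $A\le_2B$ means that for every $y\in B$ there exists some $x\in A$ with $x\le y$. Define $A\sqsubseteq B$ if and only if $A\le_1B$ and $A\le_2B$. A subset $A$ of $P$ is convex if $x,z\in A$, $y\in P$ and $x\le y\le z$ together imply $y\in A$. $\mathrm{Conv}\,\mathbf P$ denotes the set of all convex subsets of $\mathbf P$ and $\mathrm{Conv}^*\mathbf P$ denotes the set of all non-empty convex subsets of $\mathbf P$. -}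

module Defs where

open import Level using (Level; _⊔_; suc)
open import Data.Product using (Σ; ∃; _×_; _,_; proj₁)
open import Relation.Binary.Bundles using (Poset)
open import Relation.Binary.Core using (Rel)
open import Relation.Binary.Structures using (IsPartialOrder)
open import Relation.Binary.Definitions using (Minimum; Maximum)
open import Relation.Unary using (Pred; _⊆_)

module _ {c ℓ₁ ℓ₂ : Level} (𝐏 : Poset c ℓ₁ ℓ₂) where
  open Poset 𝐏

  _≤₁_ : ∀ {ℓ} → Pred Carrier ℓ → Pred Carrier ℓ → Set (c ⊔ ℓ ⊔ ℓ₂)
  A ≤₁ B = ∀ x → A x → ∃ λ y → B y × x ≤ y

  _≤₂_ : ∀ {ℓ} → Pred Carrier ℓ → Pred Carrier ℓ → Set (c ⊔ ℓ ⊔ ℓ₂)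
  A ≤₂ B = ∀ y → B y → ∃ λ x → A x × x ≤ y

  _⊑ₛ_ : ∀ {ℓ} → Pred Carrier ℓ → Pred Carrier ℓ → Set (c ⊔ ℓ ⊔ ℓ₂)
  A ⊑ₛ B = (A ≤₁ B) × (A ≤₂ B)

  IsConvex : ∀ {ℓ} → Pred Carrier ℓ → Set (c ⊔ ℓ ⊔ ℓ₂)
  IsConvex A = ∀ x y z → A x → A z → x ≤ y → y ≤ z → A y

  Conv : (ℓ : Level) → Set (c ⊔ ℓ₂ ⊔ suc ℓ)
  Conv ℓ = Σ (Pred Carrier ℓ) IsConvex

  Conv* : (ℓ : Level) → Set (c ⊔ ℓ₂ ⊔ suc ℓ)
  Conv* ℓ = Σ (Pred Carrier ℓ) (λ A → IsConvex A × ∃ λ x → A x)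

  _≐ₛ_ : ∀ {ℓ} → Pred Carrier ℓ → Pred Carrier ℓ → Set (c ⊔ ℓ)
  A ≐ₛ B = (A ⊆ B) × (B ⊆ A)

  _≐_ : ∀ {ℓ} → Rel (Conv ℓ) (c ⊔ ℓ)
  A ≐ B = proj₁ A ≐ₛ proj₁ B

  _⊑_ : ∀ {ℓ} → Rel (Conv ℓ) (c ⊔ ℓ ⊔ ℓ₂)
  A ⊑ B = proj₁ A ⊑ₛ proj₁ B

  _≐*_ : ∀ {ℓ} → Rel (Conv* ℓ) (c ⊔ ℓ)
  A ≐* B = proj₁ A ≐ₛ proj₁ B

  _⊑*_ : ∀ {ℓ} → Rel (Conv* ℓ) (c ⊔ ℓ ⊔ ℓ₂)
  A ⊑* B = proj₁ A ⊑ₛ proj₁ B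

  singleton : Carrier → Conv* ℓ₁
  singleton a = (λ x → x ≈ a)
              , (λ x y z x≈a z≈a x≤y y≤z →
                   antisym (trans y≤z (reflexive z≈a))
                           (trans (reflexive (Eq.sym x≈a)) x≤y))
              , (a , Eq.refl)

  IsBoundedConv* : (𝟎 𝟏 : Carrier) → Set (suc ℓ₁ ⊔ c ⊔ ℓ₂)
  IsBoundedConv* 𝟎 𝟏 =
    IsPartialOrder (_≐*_ {ℓ₁}) _⊑*_ × Minimum _⊑*_ (singleton 𝟎) × Maximum _⊑*_ (singleton 𝟏)

{-# OPTIONS --safe #-}
-- Reflexivity and transitivity of ⊑ hold for arbitrary subsets. For antisymmetry,
-- if A ⊑ B and B ⊑ A then every element of A lies above some element of B (B ≤₂ A)
-- and below some element of B (A ≤₁ B), so convexity of B puts it into B, and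
-- symmetrically B ⊆ A. The bounds need non-emptiness: {0} ≤₁ B and A ≤₂ {1} ask
-- for a witness in B and in A respectively.
module Submission where

open import Defs
open import Level using (Level)
open import Data.Product using (_×_; _,_; proj₁; proj₂)
open import Relation.Binary.Bundles using (Poset)
open import Relation.Binary.Structures using (IsPartialOrder; IsEquivalence)
open import Relation.Binary.Definitions using (Minimum; Maximum)
import Relation.Binary.Construct.On as On
open import Relation.Unary using (Pred; _⊆_; Satisfiable)
open import Relation.Unary.Properties using (≐-refl; ≐-sym; ≐-trans; ⊆-antisym)

module _ {c ℓ₁ ℓ₂ : Level} (𝐏 : Poset c ℓ₁ ℓ₂) where
  open Poset 𝐏

  private
    variable
      ℓ : Level
      A B C : Pred Carrier ℓ

  ≐ₛ-isEquivalence : IsEquivalence (_≐ₛ_ 𝐏 {ℓ})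
  ≐ₛ-isEquivalence = record { refl = ≐-refl ; sym = ≐-sym ; trans = ≐-trans }

  ≤₁-trans : _≤₁_ 𝐏 A B → _≤₁_ 𝐏 B C → _≤₁_ 𝐏 A C
  ≤₁-trans A≤₁B B≤₁C x x∈A =
    let (y , y∈B , x≤y) = A≤₁B x x∈A
        (z , z∈C , y≤z) = B≤₁C y y∈B
    in z , z∈C , trans x≤y y≤z

  ≤₂-trans : _≤₂_ 𝐏 A B → _≤₂_ 𝐏 B C → _≤₂_ 𝐏 A C
  ≤₂-trans A≤₂B B≤₂C z z∈C =
    let (y , y∈B , y≤z) = B≤₂C z z∈C
        (x , x∈A , x≤y) = A≤₂B y y∈B
    in x , x∈A , trans x≤y y≤z

  ⊑ₛ-reflexive : _≐ₛ_ 𝐏 A B → _⊑ₛ_ 𝐏 A B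
  ⊑ₛ-reflexive (A⊆B , B⊆A) =
    (λ x x∈A → x , A⊆B x∈A , refl) , (λ y y∈B → y , B⊆A y∈B , refl)

  ⊑ₛ-trans : _⊑ₛ_ 𝐏 A B → _⊑ₛ_ 𝐏 B C → _⊑ₛ_ 𝐏 A C
  ⊑ₛ-trans (A≤₁B , A≤₂B) (B≤₁C , B≤₂C) = ≤₁-trans A≤₁B B≤₁C , ≤₂-trans A≤₂B B≤₂C

  ≤₁-≥₂-convex⇒⊆ : IsConvex 𝐏 B → _≤₁_ 𝐏 A B → _≤₂_ 𝐏 B A → A ⊆ B
  ≤₁-≥₂-convex⇒⊆ B-convex A≤₁B B≤₂A {x} x∈A =
    let (z , z∈B , x≤z) = A≤₁B x x∈A
        (y , y∈B , y≤x) = B≤₂A x x∈A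
    in B-convex y x z y∈B z∈B y≤x x≤z

  ⊑ₛ-antisym : IsConvex 𝐏 A → IsConvex 𝐏 B →
               _⊑ₛ_ 𝐏 A B → _⊑ₛ_ 𝐏 B A → _≐ₛ_ 𝐏 A B
  ⊑ₛ-antisym A-convex B-convex (A≤₁B , A≤₂B) (B≤₁A , B≤₂A) =
    ⊆-antisym (≤₁-≥₂-convex⇒⊆ B-convex A≤₁B B≤₂A)
              (≤₁-≥₂-convex⇒⊆ A-convex B≤₁A A≤₂B)

  ⊑-isPartialOrder : IsPartialOrder (_≐_ 𝐏 {ℓ}) (_⊑_ 𝐏)
  ⊑-isPartialOrder = record
    { isPreorder = record
      { isEquivalence = On.isEquivalence proj₁ ≐ₛ-isEquivalence
      ; reflexive = ⊑ₛ-reflexive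
      ; trans = ⊑ₛ-trans
      }
    ; antisym = λ {A} {B} → ⊑ₛ-antisym (proj₂ A) (proj₂ B)
    }

  Conv*⇒Conv : Conv* 𝐏 ℓ → Conv 𝐏 ℓ
  Conv*⇒Conv (A , A-convex , _) = A , A-convex

  ⊑*-isPartialOrder : IsPartialOrder (_≐*_ 𝐏 {ℓ}) (_⊑*_ 𝐏)
  ⊑*-isPartialOrder = On.isPartialOrder Conv*⇒Conv ⊑-isPartialOrder

  singleton-minimum-⊑ₛ : ∀ {⊥} → Minimum _≤_ ⊥ → Satisfiable B →
                         _⊑ₛ_ 𝐏 (proj₁ (singleton 𝐏 ⊥)) B
  singleton-minimum-⊑ₛ {⊥ = ⊥} ⊥-min (b , b∈B) =
      (λ x x≈⊥ → b , b∈B , trans (reflexive x≈⊥) (⊥-min b))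
    , (λ y _ → ⊥ , Eq.refl , ⊥-min y)

  ⊑ₛ-singleton-maximum : ∀ {⊤} → Maximum _≤_ ⊤ → Satisfiable A →
                         _⊑ₛ_ 𝐏 A (proj₁ (singleton 𝐏 ⊤))
  ⊑ₛ-singleton-maximum {⊤ = ⊤} ⊤-max (a , a∈A) =
      (λ x _ → ⊤ , Eq.refl , ⊤-max x)
    , (λ y y≈⊤ → a , a∈A , trans (⊤-max a) (reflexive (Eq.sym y≈⊤)))

lemma5p3 : ∀ {c ℓ₁ ℓ₂} (𝐏 : Poset c ℓ₁ ℓ₂) →
    IsPartialOrder (_≐_ 𝐏 {ℓ₁}) (_⊑_ 𝐏)
    × ((𝟎 𝟏 : Poset.Carrier 𝐏) → Minimum (Poset._≤_ 𝐏) 𝟎 → Maximum (Poset._≤_ 𝐏) 𝟏 →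
       IsBoundedConv* 𝐏 𝟎 𝟏)
lemma5p3 𝐏 =
    ⊑-isPartialOrder 𝐏
  , λ 𝟎 𝟏 𝟎-min 𝟏-max →
        ⊑*-isPartialOrder 𝐏
      , (λ B → singleton-minimum-⊑ₛ 𝐏 𝟎-min (proj₂ (proj₂ B)))
      , (λ A → ⊑ₛ-singleton-maximum 𝐏 𝟏-max (proj₂ (proj₂ A)))
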